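{- There does not exist an $8\times 8$ complex matrix $H$ all of whose entries are complex $15$th roots of unity and with $HH^\ast=8I_8$; that is, $\mathrm{BH}(8,15)=\emptyset$.
   Context: $\mathrm{BH}(n,q)$ denotes the set of $n\times n$ complex matrices with all entries complex $q$th roots of unity satisfying $HH^\ast=nI_n$, where $H^\ast$ is the conjugate transpose. -}

module Defs where

open import Data.Nat using (ℕ; zero; suc; _+_; _∸_)
open import Data.Integer as ℤ using (ℤ; +_; -[1+_])
open import Data.Fin using (Fin; toℕ; _≟_)
open import Data.Vec using (Vec; []; _∷_; zipWith; replicate; foldr; tabulate; map)
open import Relation.Binary.PropositionalEquality using (_≡_)
open import Relation.Nullary using (¬_; does)
open import Data.Bool using (if_then_else_)
open import Data.Product using (∃)

-- Concrete model of the ring ℤ[ζ] ⊂ ℂ, where ζ = e^{2πi/15}.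
-- Since the minimal polynomial of ζ is the 15th cyclotomic polynomial
--   Φ₁₅(x) = x^8 - x^7 + x^5 - x^4 + x^3 - x + 1  (degree φ(15) = 8),
-- every element of ℤ[ζ] is uniquely Σ_{t<8} c_t ζ^t with c_t ∈ ℤ;
-- we represent it by its coordinate vector (c_0, …, c_7).
Cyc : Set
Cyc = Vec ℤ 8

0ᶜ : Cyc
0ᶜ = replicate 8 (+ 0)

1ᶜ : Cyc
1ᶜ = + 1 ∷ replicate 7 (+ 0)

_+ᶜ_ : Cyc → Cyc → Cyc
_+ᶜ_ = zipWith ℤ._+_

-- coordinates of ζ^8 = ζ^7 - ζ^5 + ζ^4 - ζ^3 + ζ - 1
ζ⁸ : Cyc
ζ⁸ = -[1+ 0 ] ∷ + 1 ∷ + 0 ∷ -[1+ 0 ] ∷ + 1 ∷ -[1+ 0 ] ∷ + 0 ∷ + 1 ∷ []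

mulζ : Cyc → Cyc
mulζ (c0 ∷ c1 ∷ c2 ∷ c3 ∷ c4 ∷ c5 ∷ c6 ∷ c7 ∷ []) =
  (+ 0 ∷ c0 ∷ c1 ∷ c2 ∷ c3 ∷ c4 ∷ c5 ∷ c6 ∷ []) +ᶜ map (ℤ._*_ c7) ζ⁸

ζ^ : ℕ → Cyc
ζ^ zero = 1ᶜ
ζ^ (suc a) = mulζ (ζ^ a)

root : Fin 15 → Cyc
root a = ζ^ (toℕ a)

conjRoot : Fin 15 → Cyc
conjRoot a = ζ^ (15 ∸ toℕ a)

rootTimesConj : Fin 15 → Fin 15 → Cyc
rootTimesConj a b = ζ^ (toℕ a + (15 ∸ toℕ b))

sumᶜ : ∀ {n} → Vec Cyc n → Cyc
sumᶜ = foldr _ _+ᶜ_ 0ᶜ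

_·ᶜ_ : ℕ → Cyc → Cyc
zero ·ᶜ x = 0ᶜ
suc k ·ᶜ x = x +ᶜ (k ·ᶜ x)

-- An n×n matrix with entries 15th roots of unity: entry (i,j) is ζ^(E i j).
-- (H H*)_{ij} = Σ_k H_ik · conj(H_jk)
HH* : ∀ {n} → (Fin n → Fin n → Fin 15) → Fin n → Fin n → Cyc
HH* {n} E i j = sumᶜ (tabulate λ k → rootTimesConj (E i k) (E j k))

IsBH15 : (n : ℕ) → (Fin n → Fin n → Fin 15) → Set
IsBH15 n E = ∀ i j → HH* E i j ≡ (if does (i ≟ j) then n ·ᶜ 1ᶜ else 0ᶜ)

-- Reduce modulo the prime 𝔭 = (1 − ζ⁵) of ℤ[ζ], ζ = e^{2πi/15}, which lies above 3 and has residue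
-- field 𝔽₈₁ = 𝔽₃(x) with x a primitive fifth root of unity: ζᵃ ↦ x^(a mod 5). Orthogonality of two rows
-- of H then says ∑ₖ x^(dₖ) = 0 in 𝔽₈₁, where dₖ ∈ ℤ/5 are the differences of their exponents mod 5.
-- This condition survives adding a vector to all rows, adding a constant to one row and permuting
-- columns, so six of the rows can be normalised to a zero first row and column and a sorted second row.
-- An exhaustive search over the 1680 admissible rows shows that no four further rows fit.
module Submission where

open import Defs
open import Data.Fin using (Fin)
open import Data.Product using (∃)
open import Relation.Nullary using (¬_)

open import Algebra.Bundles using (CommutativeMonoid)
open import Algebra.Structures using (IsCommutativeMonoid)
open import Data.Bool using (if_then_else_)
open import Data.Empty using (⊥)
open import Data.Fin using (zero; suc; toℕ; fromℕ; inject₁; punchIn; #_; _↑ˡ_; _≟_; _<?_; _≤_; _≤?_)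
open import Data.Fin.Permutation using (Permutation′; _⟨$⟩ʳ_; id; _∘ₚ_; transpose; lift₀)
open import Data.Fin.Properties
  using (all?; any?; suc-injective; ↑ˡ-injective; punchIn-injective; punchInᵢ≢i)
open import Data.Integer as ℤ using (ℤ; +_; -[1+_])
open import Data.Integer.Properties using ([1+m]⊖[1+n]≡m⊖n)
open import Data.List using (List; []; _∷_; [_]; map; filter; allFin; cartesianProductWith)
open import Data.List.Membership.Propositional using (_∈_)
open import Data.List.Membership.Propositional.Properties
  using (∈-filter⁺; ∈-map⁺; ∈-allFin; ∈-cartesianProductWith⁺)
open import Data.List.Relation.Unary.All as All using (All)
open import Data.List.Relation.Unary.Any using (here) renaming (tail to there⁻¹)
open import Data.Nat as ℕ using (ℕ; zero; suc)
open import Data.Nat.DivMod using (_mod_)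
open import Data.Nat.GeneralisedArithmetic using (iterate)
open import Data.Nat.Properties using (+-suc)
open import Data.Product using (_×_; _,_; proj₁; proj₂)
open import Data.Sum using ([_,_]′)
open import Data.Unit using (⊤; tt)
open import Data.Vec using (Vec; []; _∷_; lookup; tabulate; zipWith; replicate; tail)
open import Data.Vec.Properties
  using (≡-dec; lookup-replicate; lookup∘tabulate; tabulate-cong;
         zipWith-assoc; zipWith-comm; zipWith-identityˡ; zipWith-identityʳ)
open import Data.Vec.Relation.Unary.Linked using (Linked; linked?)
open import Function using (_∘_)
open import Level using (0ℓ)
open import Relation.Binary using (Rel; Decidable; DecidableEquality; Irreflexive)
open import Relation.Binary.PropositionalEquality
  using (_≡_; _≢_; _≗_; refl; sym; trans; cong; cong₂; subst; isEquivalence; module ≡-Reasoning)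
open import Relation.Nullary using (Dec; yes; no; does; _×-dec_)
open import Relation.Nullary.Decidable using (from-yes; dec-false; toSum)

open import Algebra.Definitions {A = Fin 3} _≡_
  using (Associative; Commutative; LeftIdentity; RightIdentity)

cyclicPred : ∀ {n} → Fin (suc n) → Fin (suc n)
cyclicPred zero    = fromℕ _
cyclicPred (suc i) = inject₁ i

infixl 6 _⊕_ _⊝_

-- Iterating the cyclic predecessor evaluates much faster than going through _mod_,
-- which matters for the exhaustive search at the end.
_⊝_ : ∀ {n} → Fin (suc n) → Fin (suc n) → Fin (suc n)
a ⊝ b = iterate cyclicPred a (toℕ b)

_⊕_ : ∀ {n} → Fin (suc n) → Fin (suc n) → Fin (suc n)
a ⊕ b = a ⊝ (zero ⊝ b)

𝔽₃ : Set
𝔽₃ = Fin 3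

⊕-assoc : Associative _⊕_
⊕-assoc = from-yes (all? λ (a : 𝔽₃) → all? λ (b : 𝔽₃) → all? λ (c : 𝔽₃) → a ⊕ b ⊕ c ≟ a ⊕ (b ⊕ c))

⊕-comm : Commutative _⊕_
⊕-comm = from-yes (all? λ (a : 𝔽₃) → all? λ (b : 𝔽₃) → a ⊕ b ≟ b ⊕ a)

⊕-identityˡ : LeftIdentity zero _⊕_
⊕-identityˡ = from-yes (all? λ (a : 𝔽₃) → zero ⊕ a ≟ a)

⊕-identityʳ : RightIdentity zero _⊕_
⊕-identityʳ = from-yes (all? λ (a : 𝔽₃) → a ⊕ zero ≟ a)

⊕-interchange : ∀ (a a′ b b′ : 𝔽₃) → (a ⊕ a′) ⊕ (b ⊕ b′) ≡ (a ⊕ b) ⊕ (a′ ⊕ b′)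
⊕-interchange = from-yes (all? λ (a : 𝔽₃) → all? λ (a′ : 𝔽₃) → all? λ (b : 𝔽₃) → all? λ (b′ : 𝔽₃) →
  (a ⊕ a′) ⊕ (b ⊕ b′) ≟ (a ⊕ b) ⊕ (a′ ⊕ b′))

⊝-distrib-⊕ : ∀ (a a′ b b′ : 𝔽₃) → (a ⊕ a′) ⊝ (b ⊕ b′) ≡ (a ⊝ b) ⊕ (a′ ⊝ b′)
⊝-distrib-⊕ = from-yes (all? λ (a : 𝔽₃) → all? λ (a′ : 𝔽₃) → all? λ (b : 𝔽₃) → all? λ (b′ : 𝔽₃) →
  (a ⊕ a′) ⊝ (b ⊕ b′) ≟ (a ⊝ b) ⊕ (a′ ⊝ b′))

⊝-cancelˡ : ∀ (c a b : 𝔽₃) → (c ⊕ a) ⊝ (c ⊕ b) ≡ a ⊝ b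
⊝-cancelˡ = from-yes (all? λ (c : 𝔽₃) → all? λ (a : 𝔽₃) → all? λ (b : 𝔽₃) → (c ⊕ a) ⊝ (c ⊕ b) ≟ a ⊝ b)

⊝-as-⊕ : ∀ (a b : 𝔽₃) → a ⊝ b ≡ a ⊕ (zero ⊝ b)
⊝-as-⊕ = from-yes (all? λ (a : 𝔽₃) → all? λ (b : 𝔽₃) → a ⊝ b ≟ a ⊕ (zero ⊝ b))

⊝-self : ∀ (a : Fin 5) → a ⊝ a ≡ zero
⊝-self = from-yes (all? λ (a : Fin 5) → a ⊝ a ≟ zero)

⊝-cancelʳ : ∀ (a b c : Fin 5) → (a ⊝ c) ⊝ (b ⊝ c) ≡ a ⊝ b
⊝-cancelʳ = from-yes (all? λ (a : Fin 5) → all? λ (b : Fin 5) → all? λ (c : Fin 5) →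
  (a ⊝ c) ⊝ (b ⊝ c) ≟ a ⊝ b)

⊝-interchange : ∀ (a b c d : Fin 5) → (a ⊝ c) ⊝ (b ⊝ d) ≡ (a ⊝ b) ⊝ (c ⊝ d)
⊝-interchange = from-yes (all? λ (a : Fin 5) → all? λ (b : Fin 5) → all? λ (c : Fin 5) → all? λ (d : Fin 5) →
  (a ⊝ c) ⊝ (b ⊝ d) ≟ (a ⊝ b) ⊝ (c ⊝ d))

-- 𝔽₈₁ = 𝔽₃[x]/(1 + x + x² + x³ + x⁴), in the basis 1, x, x², x³.
𝔽₈₁ : Set
𝔽₈₁ = Vec 𝔽₃ 4

infixl 6 _+ᶠ_

_+ᶠ_ : 𝔽₈₁ → 𝔽₈₁ → 𝔽₈₁
_+ᶠ_ = zipWith _⊕_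

0ᶠ : 𝔽₈₁
0ᶠ = replicate 4 zero

+ᶠ-isCommutativeMonoid : IsCommutativeMonoid _≡_ _+ᶠ_ 0ᶠ
+ᶠ-isCommutativeMonoid = record
  { isMonoid = record
    { isSemigroup = record
      { isMagma = record { isEquivalence = isEquivalence ; ∙-cong = cong₂ _+ᶠ_ }
      ; assoc   = zipWith-assoc ⊕-assoc
      }
    ; identity = zipWith-identityˡ ⊕-identityˡ , zipWith-identityʳ ⊕-identityʳ
    }
  ; comm = zipWith-comm ⊕-comm
  }

+ᶠ-commutativeMonoid : CommutativeMonoid 0ℓ 0ℓ
+ᶠ-commutativeMonoid = record { isCommutativeMonoid = +ᶠ-isCommutativeMonoid }

open import Algebra.Properties.CommutativeMonoid.Sum +ᶠ-commutativeMonoid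
  using (sum-syntax; sum-cong-≗; ∑-permute)

∑-homo : ∀ (h : 𝔽₈₁ → 𝔽₈₁) → (∀ a b → h (a +ᶠ b) ≡ h a +ᶠ h b) → h 0ᶠ ≡ 0ᶠ →
         ∀ {n} (f : Fin n → 𝔽₈₁) → h (∑[ k < n ] f k) ≡ ∑[ k < n ] h (f k)
∑-homo h h-+ h-0 {zero}  f = h-0
∑-homo h h-+ h-0 {suc n} f = trans (h-+ _ _) (cong (h (f zero) +ᶠ_) (∑-homo h h-+ h-0 (f ∘ suc)))

-- x⁴ = −1 − x − x² − x³
x^ : Fin 5 → 𝔽₈₁
x^ = lookup ( (# 1 ∷ # 0 ∷ # 0 ∷ # 0 ∷ []) ∷ (# 0 ∷ # 1 ∷ # 0 ∷ # 0 ∷ []) ∷ (# 0 ∷ # 0 ∷ # 1 ∷ # 0 ∷ [])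
            ∷ (# 0 ∷ # 0 ∷ # 0 ∷ # 1 ∷ []) ∷ (# 2 ∷ # 2 ∷ # 2 ∷ # 2 ∷ []) ∷ [])

x⁻¹· : 𝔽₈₁ → 𝔽₈₁
x⁻¹· (a₀ ∷ a₁ ∷ a₂ ∷ a₃ ∷ []) = a₁ ⊝ a₀ ∷ a₂ ⊝ a₀ ∷ a₃ ⊝ a₀ ∷ zero ⊝ a₀ ∷ []

x⁻¹·-+ : ∀ a b → x⁻¹· (a +ᶠ b) ≡ x⁻¹· a +ᶠ x⁻¹· b
x⁻¹·-+ (a₀ ∷ a₁ ∷ a₂ ∷ a₃ ∷ []) (b₀ ∷ b₁ ∷ b₂ ∷ b₃ ∷ []) =
  cong₂ _∷_ (⊝-distrib-⊕ a₁ b₁ a₀ b₀) (cong₂ _∷_ (⊝-distrib-⊕ a₂ b₂ a₀ b₀)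
    (cong₂ _∷_ (⊝-distrib-⊕ a₃ b₃ a₀ b₀) (cong (_∷ []) (⊝-distrib-⊕ zero zero a₀ b₀))))

x⁻ˢ· : ℕ → 𝔽₈₁ → 𝔽₈₁
x⁻ˢ· s a = iterate x⁻¹· a s

x⁻ˢ·-+ : ∀ s a b → x⁻ˢ· s (a +ᶠ b) ≡ x⁻ˢ· s a +ᶠ x⁻ˢ· s b
x⁻ˢ·-+ zero    a b = refl
x⁻ˢ·-+ (suc s) a b = trans (cong (x⁻ˢ· s) (x⁻¹·-+ a b)) (x⁻ˢ·-+ s _ _)

x⁻ˢ·-0 : ∀ s → x⁻ˢ· s 0ᶠ ≡ 0ᶠ
x⁻ˢ·-0 zero    = refl
x⁻ˢ·-0 (suc s) = x⁻ˢ·-0 s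

x^-⊝ : ∀ t s → x^ (t ⊝ s) ≡ x⁻ˢ· (toℕ s) (x^ t)
x^-⊝ = from-yes (all? λ (t : Fin 5) → all? λ (s : Fin 5) → ≡-dec _≟_ (x^ (t ⊝ s)) (x⁻ˢ· (toℕ s) (x^ t)))

-- Reduction of ℤ[ζ] modulo 1 − ζ⁵

ℕ→𝔽₃ : ℕ → 𝔽₃
ℕ→𝔽₃ zero    = zero
ℕ→𝔽₃ (suc n) = # 1 ⊕ ℕ→𝔽₃ n

ℤ→𝔽₃ : ℤ → 𝔽₃
ℤ→𝔽₃ (+ n)    = ℕ→𝔽₃ n
ℤ→𝔽₃ -[1+ n ] = zero ⊝ ℕ→𝔽₃ (suc n)

ℕ→𝔽₃-+ : ∀ m n → ℕ→𝔽₃ (m ℕ.+ n) ≡ ℕ→𝔽₃ m ⊕ ℕ→𝔽₃ n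
ℕ→𝔽₃-+ zero    n = sym (⊕-identityˡ (ℕ→𝔽₃ n))
ℕ→𝔽₃-+ (suc m) n = trans (cong (# 1 ⊕_) (ℕ→𝔽₃-+ m n)) (sym (⊕-assoc (# 1) (ℕ→𝔽₃ m) (ℕ→𝔽₃ n)))

ℤ→𝔽₃-⊖ : ∀ m n → ℤ→𝔽₃ (m ℤ.⊖ n) ≡ ℕ→𝔽₃ m ⊝ ℕ→𝔽₃ n
ℤ→𝔽₃-⊖ zero    zero    = refl
ℤ→𝔽₃-⊖ (suc m) zero    = refl
ℤ→𝔽₃-⊖ zero    (suc n) = refl
ℤ→𝔽₃-⊖ (suc m) (suc n) = begin
  ℤ→𝔽₃ (suc m ℤ.⊖ suc n)       ≡⟨ cong ℤ→𝔽₃ ([1+m]⊖[1+n]≡m⊖n m n) ⟩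
  ℤ→𝔽₃ (m ℤ.⊖ n)               ≡⟨ ℤ→𝔽₃-⊖ m n ⟩
  ℕ→𝔽₃ m ⊝ ℕ→𝔽₃ n              ≡⟨ ⊝-cancelˡ (# 1) (ℕ→𝔽₃ m) (ℕ→𝔽₃ n) ⟨
  ℕ→𝔽₃ (suc m) ⊝ ℕ→𝔽₃ (suc n)  ∎
  where open ≡-Reasoning

ℤ→𝔽₃-+ : ∀ i j → ℤ→𝔽₃ (i ℤ.+ j) ≡ ℤ→𝔽₃ i ⊕ ℤ→𝔽₃ j
ℤ→𝔽₃-+ (+ m)    (+ n)    = ℕ→𝔽₃-+ m n
ℤ→𝔽₃-+ (+ m)    -[1+ n ] = trans (ℤ→𝔽₃-⊖ m (suc n)) (⊝-as-⊕ (ℕ→𝔽₃ m) (ℕ→𝔽₃ (suc n)))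
ℤ→𝔽₃-+ -[1+ m ] (+ n)    = begin
  ℤ→𝔽₃ (n ℤ.⊖ suc m)                ≡⟨ ℤ→𝔽₃-⊖ n (suc m) ⟩
  ℕ→𝔽₃ n ⊝ ℕ→𝔽₃ (suc m)             ≡⟨ ⊝-as-⊕ (ℕ→𝔽₃ n) (ℕ→𝔽₃ (suc m)) ⟩
  ℕ→𝔽₃ n ⊕ (zero ⊝ ℕ→𝔽₃ (suc m))    ≡⟨ ⊕-comm (ℕ→𝔽₃ n) (zero ⊝ ℕ→𝔽₃ (suc m)) ⟩
  (zero ⊝ ℕ→𝔽₃ (suc m)) ⊕ ℕ→𝔽₃ n    ∎
  where open ≡-Reasoning
ℤ→𝔽₃-+ -[1+ m ] -[1+ n ] = begin
  zero ⊝ ℕ→𝔽₃ (suc (suc (m ℕ.+ n)))                 ≡⟨ cong (λ k → zero ⊝ ℕ→𝔽₃ k) (+-suc (suc m) n) ⟨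
  zero ⊝ ℕ→𝔽₃ (suc m ℕ.+ suc n)                     ≡⟨ cong (zero ⊝_) (ℕ→𝔽₃-+ (suc m) (suc n)) ⟩
  zero ⊝ (ℕ→𝔽₃ (suc m) ⊕ ℕ→𝔽₃ (suc n))              ≡⟨ ⊝-distrib-⊕ zero zero (ℕ→𝔽₃ (suc m)) (ℕ→𝔽₃ (suc n)) ⟩
  (zero ⊝ ℕ→𝔽₃ (suc m)) ⊕ (zero ⊝ ℕ→𝔽₃ (suc n))     ∎
  where open ≡-Reasoning

coefficient : ℤ → ℤ → ℤ → 𝔽₃
coefficient a b c = ℤ→𝔽₃ a ⊕ ℤ→𝔽₃ b ⊝ ℤ→𝔽₃ c

coefficient-+ : ∀ a a′ b b′ c c′ →
  coefficient (a ℤ.+ a′) (b ℤ.+ b′) (c ℤ.+ c′) ≡ coefficient a b c ⊕ coefficient a′ b′ c′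
coefficient-+ a a′ b b′ c c′ = begin
  coefficient (a ℤ.+ a′) (b ℤ.+ b′) (c ℤ.+ c′)
    ≡⟨ cong₂ _⊝_ (cong₂ _⊕_ (ℤ→𝔽₃-+ a a′) (ℤ→𝔽₃-+ b b′)) (ℤ→𝔽₃-+ c c′) ⟩
  (A ⊕ A′) ⊕ (B ⊕ B′) ⊝ (C ⊕ C′)  ≡⟨ cong (_⊝ (C ⊕ C′)) (⊕-interchange A A′ B B′) ⟩
  (A ⊕ B) ⊕ (A′ ⊕ B′) ⊝ (C ⊕ C′)  ≡⟨ ⊝-distrib-⊕ (A ⊕ B) (A′ ⊕ B′) C C′ ⟩
  coefficient a b c ⊕ coefficient a′ b′ c′ ∎
  where
  open ≡-Reasoning
  A = ℤ→𝔽₃ a; A′ = ℤ→𝔽₃ a′; B = ℤ→𝔽₃ b; B′ = ℤ→𝔽₃ b′; C = ℤ→𝔽₃ c; C′ = ℤ→𝔽₃ c′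

-- ζᵗ ↦ x^(t mod 5), so the coefficient of xᵗ is cₜ + cₜ₊₅ − c₄.
ψ : Cyc → 𝔽₈₁
ψ (c₀ ∷ c₁ ∷ c₂ ∷ c₃ ∷ c₄ ∷ c₅ ∷ c₆ ∷ c₇ ∷ []) =
  coefficient c₀ c₅ c₄ ∷ coefficient c₁ c₆ c₄ ∷ coefficient c₂ c₇ c₄ ∷ coefficient c₃ (+ 0) c₄ ∷ []

ψ-+ : ∀ c d → ψ (c +ᶜ d) ≡ ψ c +ᶠ ψ d
ψ-+ (c₀ ∷ c₁ ∷ c₂ ∷ c₃ ∷ c₄ ∷ c₅ ∷ c₆ ∷ c₇ ∷ []) (d₀ ∷ d₁ ∷ d₂ ∷ d₃ ∷ d₄ ∷ d₅ ∷ d₆ ∷ d₇ ∷ []) =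
  cong₂ _∷_ (coefficient-+ c₀ d₀ c₅ d₅ c₄ d₄) (cong₂ _∷_ (coefficient-+ c₁ d₁ c₆ d₆ c₄ d₄)
    (cong₂ _∷_ (coefficient-+ c₂ d₂ c₇ d₇ c₄ d₄) (cong (_∷ []) (coefficient-+ c₃ d₃ (+ 0) (+ 0) c₄ d₄))))

ψ-sumᶜ : ∀ {n} (f : Fin n → Cyc) → ψ (sumᶜ (tabulate f)) ≡ ∑[ k < n ] ψ (f k)
ψ-sumᶜ {zero}  f = refl
ψ-sumᶜ {suc n} f = trans (ψ-+ (f zero) _) (cong (ψ (f zero) +ᶠ_) (ψ-sumᶜ (f ∘ suc)))

mod5 : Fin 15 → Fin 5
mod5 a = toℕ a mod 5

ψ-rootTimesConj : ∀ a b → ψ (rootTimesConj a b) ≡ x^ (mod5 a ⊝ mod5 b)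
ψ-rootTimesConj = from-yes (all? λ (a : Fin 15) → all? λ (b : Fin 15) →
  ≡-dec _≟_ (ψ (rootTimesConj a b)) (x^ (mod5 a ⊝ mod5 b)))

Orthogonal : ∀ {n} → (Fin n → Fin 5) → (Fin n → Fin 5) → Set
Orthogonal {n} u v = ∑[ k < n ] x^ (u k ⊝ v k) ≡ 0ᶠ

PairwiseOrthogonal : ∀ {m n} → (Fin m → Fin n → Fin 5) → Set
PairwiseOrthogonal x = ∀ {i j} → i ≢ j → Orthogonal (x i) (x j)

bh⇒pairwiseOrthogonal : ∀ {n} {E : Fin n → Fin n → Fin 15} → IsBH15 n E →
                        PairwiseOrthogonal (λ i k → mod5 (E i k))
bh⇒pairwiseOrthogonal {n} {E} bh {i} {j} i≢j = begin
  ∑[ k < n ] x^ (mod5 (E i k) ⊝ mod5 (E j k))   ≡⟨ sum-cong-≗ (λ k → ψ-rootTimesConj (E i k) (E j k)) ⟨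
  ∑[ k < n ] ψ (rootTimesConj (E i k) (E j k))  ≡⟨ ψ-sumᶜ (λ k → rootTimesConj (E i k) (E j k)) ⟨
  ψ (HH* E i j)                                  ≡⟨ cong ψ (bh i j) ⟩
  ψ (if does (i ≟ j) then n ·ᶜ 1ᶜ else 0ᶜ)       ≡⟨ cong (λ b → ψ (if b then n ·ᶜ 1ᶜ else 0ᶜ))
                                                         (dec-false (i ≟ j) i≢j) ⟩
  ψ 0ᶜ                                           ≡⟨⟩
  0ᶠ                                             ∎
  where open ≡-Reasoning

module _ {n} {u v : Fin n → Fin 5} where

  orthogonal-cong : ∀ {u′ v′} → u ≗ u′ → v ≗ v′ → Orthogonal u v → Orthogonal u′ v′
  orthogonal-cong u≗u′ v≗v′ =
    trans (sum-cong-≗ λ k → cong₂ (λ a b → x^ (a ⊝ b)) (sym (u≗u′ k)) (sym (v≗v′ k)))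

  orthogonal-translate : ∀ (w : Fin n → Fin 5) →
                         Orthogonal u v → Orthogonal (λ k → u k ⊝ w k) (λ k → v k ⊝ w k)
  orthogonal-translate w = trans (sum-cong-≗ λ k → cong x^ (⊝-cancelʳ (u k) (v k) (w k)))

  -- Shifting the exponent differences by s multiplies their sum in 𝔽₈₁ by x⁻ˢ.
  orthogonal-shift : ∀ (c d : Fin 5) → Orthogonal u v → Orthogonal (λ k → u k ⊝ c) (λ k → v k ⊝ d)
  orthogonal-shift c d uv = begin
    ∑[ k < n ] x^ ((u k ⊝ c) ⊝ (v k ⊝ d))  ≡⟨ sum-cong-≗ (λ k → cong x^ (⊝-interchange (u k) (v k) c d)) ⟩
    ∑[ k < n ] x^ ((u k ⊝ v k) ⊝ s)        ≡⟨ sum-cong-≗ (λ k → x^-⊝ (u k ⊝ v k) s) ⟩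
    ∑[ k < n ] x⁻ˢ· (toℕ s) (x^ (u k ⊝ v k))
      ≡⟨ ∑-homo (x⁻ˢ· (toℕ s)) (x⁻ˢ·-+ (toℕ s)) (x⁻ˢ·-0 (toℕ s)) (λ k → x^ (u k ⊝ v k)) ⟨
    x⁻ˢ· (toℕ s) (∑[ k < n ] x^ (u k ⊝ v k))  ≡⟨ cong (x⁻ˢ· (toℕ s)) uv ⟩
    x⁻ˢ· (toℕ s) 0ᶠ                           ≡⟨ x⁻ˢ·-0 (toℕ s) ⟩
    0ᶠ                                        ∎
    where
    open ≡-Reasoning
    s = c ⊝ d

  orthogonal-permute : ∀ (π : Permutation′ n) → Orthogonal u v → Orthogonal (u ∘ (π ⟨$⟩ʳ_)) (v ∘ (π ⟨$⟩ʳ_))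
  orthogonal-permute π = trans (sym (∑-permute _ π))

record Normalised {m n} (z : Fin (suc m) → Fin (suc n) → Fin 5) : Set where
  field
    pairwiseOrthogonal : PairwiseOrthogonal z
    firstRow           : ∀ k → z zero k ≡ zero
    firstColumn        : ∀ i → z i zero ≡ zero

dephase : ∀ {m n} → (Fin (suc m) → Fin (suc n) → Fin 5) → Fin (suc m) → Fin (suc n) → Fin 5
dephase x i k = x i k ⊝ x zero k ⊝ (x i zero ⊝ x zero zero)

dephase-normalised : ∀ {m n} {x : Fin (suc m) → Fin (suc n) → Fin 5} →
                     PairwiseOrthogonal x → Normalised (dephase x)
dephase-normalised {x = x} ortho = record
  { pairwiseOrthogonal = λ {i} {j} i≢j →
      orthogonal-shift {u = λ k → x i k ⊝ x zero k} {v = λ k → x j k ⊝ x zero k}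
        (x i zero ⊝ x zero zero) (x j zero ⊝ x zero zero)
        (orthogonal-translate {u = x i} {v = x j} (x zero) (ortho i≢j))
  ; firstRow    = λ k → cong₂ _⊝_ (⊝-self (x zero k)) (⊝-self (x zero zero))
  ; firstColumn = λ i → ⊝-self (x i zero ⊝ x zero zero)
  }

permuteColumns-normalised : ∀ {m n} {z : Fin (suc m) → Fin (suc n) → Fin 5} (π : Permutation′ n) →
                            Normalised z → Normalised (λ i → z i ∘ (lift₀ π ⟨$⟩ʳ_))
permuteColumns-normalised {z = z} π nz = record
  { pairwiseOrthogonal = λ {i} {j} i≢j →
      orthogonal-permute {u = z i} {v = z j} (lift₀ π) (pairwiseOrthogonal i≢j)
  ; firstRow    = firstRow ∘ (lift₀ π ⟨$⟩ʳ_)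
  ; firstColumn = firstColumn
  }
  where open Normalised nz

infix 4 _⟂_ _⟂?_

_⟂_ : ∀ {n} → Vec (Fin 5) n → Vec (Fin 5) n → Set
u ⟂ v = Orthogonal (lookup u) (lookup v)

_⟂?_ : ∀ {n} → Decidable (_⟂_ {n})
_⟂?_ {n} u v = ≡-dec _≟_ (∑[ k < n ] x^ (lookup u k ⊝ lookup v k)) 0ᶠ

tabulate-⟂ : ∀ {n} {u v : Fin n → Fin 5} → Orthogonal u v → tabulate u ⟂ tabulate v
tabulate-⟂ {u = u} {v} = orthogonal-cong (sym ∘ lookup∘tabulate u) (sym ∘ lookup∘tabulate v)

-- u ⟂ u would say 8 = 0 in 𝔽₃.
⟂-irreflexive : Irreflexive _≡_ (_⟂_ {8})
⟂-irreflexive {u} refl uu with () ← trans (sym (sum-cong-≗ λ k → cong x^ (⊝-self (lookup u k)))) uu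

permute : ∀ {A : Set} {n} → Permutation′ n → Vec A n → Vec A n
permute π v = tabulate (lookup v ∘ (π ⟨$⟩ʳ_))

-- Opaque, like the enumeration below, so that the type checker never unfolds them while comparing
-- types (on symbolic rows this explodes); only the search evaluates them.
opaque
  argmin : ∀ {m n} → Vec (Fin m) (suc n) → Fin (suc n)
  argmin             (x ∷ [])  = zero
  argmin {n = suc n} (x ∷ xs) = pick (argmin xs)
    where
    pick : Fin (suc n) → Fin (suc (suc n))
    pick j = if does (lookup xs j <? x) then suc j else zero

  sortingPermutation : ∀ {m n} → Vec (Fin m) n → Permutation′ n
  sortingPermutation             [] = id
  sortingPermutation {n = suc n} v  = lift₀ (sortingPermutation (tail (permute τ v))) ∘ₚ τ
    where
    τ : Permutation′ (suc n)
    τ = transpose zero (argmin v)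

sortTail : ∀ {m n} → Vec (Fin m) (suc n) → Vec (Fin m) (suc n)
sortTail v = permute (lift₀ (sortingPermutation (tail v))) v

Sorted : ∀ {m n} → Vec (Fin m) n → Set
Sorted = Linked _≤_

IsClique : ∀ {A : Set} {k} → Rel A 0ℓ → (Fin k → A) → Set
IsClique R c = ∀ {i j} → i ≢ j → R (c i) (c j)

module _ {A : Set} {R : Rel A 0ℓ} (R? : Decidable R) where

  CliqueFree : ℕ → List A → Set
  CliqueFree zero    _        = ⊥
  CliqueFree (suc k) []       = ⊤
  CliqueFree (suc k) (x ∷ xs) = CliqueFree k (filter (R? x) xs) × CliqueFree (suc k) xs

  cliqueFree? : ∀ k xs → Dec (CliqueFree k xs)
  cliqueFree? zero    _        = no λ ()
  cliqueFree? (suc k) []       = yes tt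
  cliqueFree? (suc k) (x ∷ xs) = cliqueFree? k (filter (R? x) xs) ×-dec cliqueFree? (suc k) xs

  -- A clique either contains the head x, and the rest of it lies among the R-neighbours of x
  -- further down the list, or it avoids x altogether.
  cliqueFree⇒¬clique : DecidableEquality A → Irreflexive _≡_ R → ∀ {k} xs → CliqueFree k xs →
                       (c : Fin k → A) → (∀ i → c i ∈ xs) → ¬ IsClique R c
  cliqueFree⇒¬clique _≟ᴬ_ irr {zero}  _        ()
  cliqueFree⇒¬clique _≟ᴬ_ irr {suc k} []       _ c c∈ _ with () ← c∈ zero
  cliqueFree⇒¬clique _≟ᴬ_ irr {suc k} (x ∷ xs) (free-with-x , free-without-x) c c∈ clique =
    [ (λ (i , cᵢ≡x) → cliqueFree⇒¬clique _≟ᴬ_ irr (filter (R? x) xs) free-with-x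
                         (c ∘ punchIn i) (rest∈ cᵢ≡x) (λ j≢j′ → clique (j≢j′ ∘ punchIn-injective i _ _)))
    , (λ ∄i → cliqueFree⇒¬clique _≟ᴬ_ irr xs free-without-x c (λ i → there⁻¹ (∄i ∘ (i ,_)) (c∈ i)) clique)
    ]′ (toSum (any? λ i → c i ≟ᴬ x))
    where
    R-x : ∀ {i} → c i ≡ x → ∀ j → R x (c (punchIn i j))
    R-x {i} cᵢ≡x j = subst (λ y → R y (c (punchIn i j))) cᵢ≡x (clique (punchInᵢ≢i i j ∘ sym))
    rest∈ : ∀ {i} → c i ≡ x → ∀ j → c (punchIn i j) ∈ filter (R? x) xs
    rest∈ {i} cᵢ≡x j = ∈-filter⁺ (R? x)
      (there⁻¹ (λ cⱼ≡x → irr (sym cⱼ≡x) (R-x cᵢ≡x j)) (c∈ (punchIn i j))) (R-x cᵢ≡x j)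

opaque
  vectors : ∀ {A : Set} → List A → ∀ n → List (Vec A n)
  vectors xs zero    = [ [] ]
  vectors xs (suc n) = cartesianProductWith _∷_ xs (vectors xs n)

  ∈-vectors : ∀ {A : Set} {xs : List A} → (∀ x → x ∈ xs) → ∀ {n} (v : Vec A n) → v ∈ vectors xs n
  ∈-vectors all∈ []      = here refl
  ∈-vectors all∈ (x ∷ v) = ∈-cartesianProductWith⁺ _∷_ (all∈ x) (∈-vectors all∈ v)

zeros : Vec (Fin 5) 8
zeros = replicate 8 zero

candidates : List (Vec (Fin 5) 8)
candidates = filter (_⟂? zeros) (map (zero ∷_) (vectors (allFin 5) 7))

normalised-row∈candidates : ∀ {m} {z : Fin (suc m) → Fin 8 → Fin 5} → Normalised z →
                            ∀ {i} → i ≢ zero → tabulate (z i) ∈ candidates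
normalised-row∈candidates {z = z} nz {i} i≢0 = ∈-filter⁺ (_⟂? zeros) row∈ row⟂zeros
  where
  open Normalised nz
  row∈ : tabulate (z i) ∈ map (zero ∷_) (vectors (allFin 5) 7)
  row∈ = subst (λ a → a ∷ tabulate (z i ∘ suc) ∈ map (zero ∷_) (vectors (allFin 5) 7)) (sym (firstColumn i))
           (∈-map⁺ (zero ∷_) (∈-vectors ∈-allFin (tabulate (z i ∘ suc))))
  row⟂zeros : tabulate (z i) ⟂ zeros
  row⟂zeros = orthogonal-cong (sym ∘ lookup∘tabulate (z i))
                (λ k → trans (firstRow k) (sym (lookup-replicate k zero))) (pairwiseOrthogonal i≢0)

SearchResult : List (Vec (Fin 5) 8) → Set
SearchResult vs = All (Sorted ∘ sortTail) vs
                × All (λ v → CliqueFree _⟂?_ 4 (filter (v ⟂?_) vs)) (filter (linked? _≤?_) vs)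

search? : ∀ vs → Dec (SearchResult vs)
search? vs = All.all? (linked? _≤?_ ∘ sortTail) vs
       ×-dec All.all? (λ v → cliqueFree? _⟂?_ 4 (filter (v ⟂?_) vs)) (filter (linked? _≤?_) vs)

-- Both parts are decided in one evaluation so that the list of candidates is computed only once.
opaque
  unfolding vectors sortingPermutation

  search : SearchResult candidates
  search = from-yes (search? candidates)

noSixPairwiseOrthogonalRows : (x : Fin 6 → Fin 8 → Fin 5) → ¬ PairwiseOrthogonal x
noSixPairwiseOrthogonalRows x ortho =
  cliqueFree⇒¬clique _⟂?_ (≡-dec _≟_) ⟂-irreflexive (filter (r₁ ⟂?_) candidates)
    (All.lookup (proj₂ search) r₁∈sortedCandidates) rows rows∈ rows-isClique
  where
  y = dephase x
  ny : Normalised y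
  ny = dephase-normalised {x = x} ortho
  σ = sortingPermutation (tail (tabulate (y (# 1))))
  z : Fin 6 → Fin 8 → Fin 5
  z i = y i ∘ (lift₀ σ ⟨$⟩ʳ_)
  nz : Normalised z
  nz = permuteColumns-normalised σ ny
  open Normalised nz
  r₁ : Vec (Fin 5) 8
  r₁ = tabulate (z (# 1))
  r₁-sorted : Sorted r₁
  r₁-sorted = subst Sorted (tabulate-cong λ k → lookup∘tabulate (y (# 1)) (lift₀ σ ⟨$⟩ʳ k))
                (All.lookup (proj₁ search) (normalised-row∈candidates ny λ ()))
  r₁∈sortedCandidates : r₁ ∈ filter (linked? _≤?_) candidates
  r₁∈sortedCandidates = ∈-filter⁺ (linked? _≤?_) (normalised-row∈candidates nz λ ()) r₁-sorted
  rows : Fin 4 → Vec (Fin 5) 8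
  rows i = tabulate (z (suc (suc i)))
  rows∈ : ∀ i → rows i ∈ filter (r₁ ⟂?_) candidates
  rows∈ i = ∈-filter⁺ (r₁ ⟂?_) (normalised-row∈candidates nz λ ())
              (tabulate-⟂ {u = z (# 1)} {v = z (suc (suc i))} (pairwiseOrthogonal λ ()))
  rows-isClique : IsClique _⟂_ rows
  rows-isClique {i} {j} i≢j = tabulate-⟂ {u = z (suc (suc i))} {v = z (suc (suc j))}
                                (pairwiseOrthogonal (i≢j ∘ suc-injective ∘ suc-injective))

mainTheorem7 : ¬ (∃ λ (E : Fin 8 → Fin 8 → Fin 15) → IsBH15 8 E)
mainTheorem7 (E , bh) = noSixPairwiseOrthogonalRows (λ i k → mod5 (E (i ↑ˡ 2) k))
  (λ i≢j → bh⇒pairwiseOrthogonal {E = E} bh (i≢j ∘ ↑ˡ-injective 2 _ _))
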